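{- Let $\mathcal{C}$ be a clutter with vertex set $X=\{x_1,\dots,x_n\}$ that has the free vertex property. Then the simplicial complex $\Delta_{\mathcal{C}}$ is shellable.
   Context: A clutter $\mathcal{C}$ with vertex set $X=\{x_1,\dots,x_n\}$ is a family of subsets of $X$ (edges), none contained in another. Its edge ideal is $I(\mathcal{C})\subset R=k[x_1,\dots,x_n]$ ($k$ a field), generated by the squarefree monomials $\prod_{x\in S}x$ for edges $S$; conversely, an ideal minimally generated by squarefree monomials $x^{v_1},\dots,x^{v_q}$ defines the clutter whose edges are the supports of the $x^{v_i}$. $\Delta_{\mathcal{C}}$ is the Stanley–Reisner complex of $I(\mathcal{C})$ on $X$; its facets are exactly the sets $X\setminus C$ with $C$ a minimal vertex cover of $\mathcal{C}$ (a vertex cover is a set meeting every edge). A simplicial complex is shellable if its facets can be ordered $F_1,\dots,F_s$ so that for all $1\le i<j\le s$ there exist $v\in F_j\setminus F_i$ and $\ell\in\{1,\dots,j-1\}$ with $F_j\setminus F_\ell=\{v\}$ (non-pure shellability). A minor of $I=I(\mathcal{C})$ is an ideal $I'$ of $R'=k[X\setminus X']$, for some subset $X'=\{x_{i_1},\dots,x_{i_r},x_{j_1},\dots,x_{j_s}\}\subset X$, obtained from the generators of $I$ by setting $x_{i_a}=0$ and $x_{j_b}=1$ for all $a,b$, provided $(0)\subsetneq I'\subsetneq R'$; $I$ itself is also a minor. A minor of $\mathcal{C}$ is the clutter on $X\setminus X'$ whose edges are the supports of the minimal squarefree monomial generators of such a minor $I'$. A vertex is free in a clutter if it lies in exactly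 one edge. $\mathcal{C}$ has the free vertex property if every minor of $\mathcal{C}$ (including $\mathcal{C}$) has a free vertex. -}

module Defs where

open import Data.Nat using (ℕ)
open import Data.Bool using (Bool; true)
open import Data.Fin as Fin using (Fin)
open import Data.Fin.Subset using (Subset; _∈_; _∉_; _⊆_; ∁; _∩_; _─_; ⁅_⁆; Nonempty; Empty)
open import Data.List using (List; length; lookup)
open import Data.List.Relation.Unary.All using (All)
open import Data.List.Relation.Unary.Unique.Propositional using (Unique)
open import Data.List.Membership.Propositional using () renaming (_∈_ to _∈ˡ_)
open import Data.Product using (Σ; ∃; ∃-syntax; _×_)
open import Relation.Binary.PropositionalEquality using (_≡_)

Family : ℕ → Set
Family n = Subset n → Bool

module _ {n : ℕ} where

  IsEdge : Family n → Subset n → Set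
  IsEdge E S = E S ≡ true

  IsClutter : Family n → Set
  IsClutter E = ∀ S T → IsEdge E S → IsEdge E T → S ⊆ T → S ≡ T

  HasFreeVertex : (Subset n → Set) → Set
  HasFreeVertex P =
    ∃[ v ] ∃[ T ] (P T × v ∈ T × (∀ T′ → P T′ → v ∈ T′ → T′ ≡ T))

  Disjoint : Subset n → Subset n → Set
  Disjoint A B = ∀ x → x ∈ A → x ∉ B

  -- Setting x_a = 0 for a ∈ A and x_b = 1 for b ∈ B (A, B disjoint):
  -- the generators x^S with S ∩ A = ∅ survive and become x^(S ∖ B).
  -- T is the support of such a resulting generator.
  ReducedEdge : Family n → Subset n → Subset n → Subset n → Set
  ReducedEdge E A B T = ∃[ S ] (IsEdge E S × Empty (S ∩ A) × T ≡ S ─ B)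

  -- Edges of the minor: supports of the minimal generators, i.e. the
  -- inclusion-minimal reduced edges.
  MinorEdge : Family n → Subset n → Subset n → Subset n → Set
  MinorEdge E A B T =
    ReducedEdge E A B T × (∀ T′ → ReducedEdge E A B T′ → T′ ⊆ T → T′ ≡ T)

  -- (0) ⊊ I′ ⊊ R′ : some generator survives, and no generator becomes 1.
  IsProperMinor : Family n → Subset n → Subset n → Set
  IsProperMinor E A B =
    Disjoint A B
    × (∃[ T ] ReducedEdge E A B T)
    × (∀ T → ReducedEdge E A B T → Nonempty T)

  FreeVertexProperty : Family n → Set
  FreeVertexProperty E =
    HasFreeVertex (IsEdge E)
    × (∀ A B → IsProperMinor E A B → HasFreeVertex (MinorEdge E A B))

  IsVertexCover : Family n → Subset n → Set
  IsVertexCover E C = ∀ S → IsEdge E S → Nonempty (S ∩ C)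

  IsMinimalVertexCover : Family n → Subset n → Set
  IsMinimalVertexCover E C =
    IsVertexCover E C × (∀ C′ → IsVertexCover E C′ → C′ ⊆ C → C′ ≡ C)

  -- Facets of the Stanley–Reisner complex Δ_C of I(C): X ∖ C for C a
  -- minimal vertex cover.
  IsFacetΔ : Family n → Subset n → Set
  IsFacetΔ E F = ∃[ C ] (IsMinimalVertexCover E C × F ≡ ∁ C)

  IsShelling : (Subset n → Set) → List (Subset n) → Set
  IsShelling Facet Fs =
    Unique Fs × All Facet Fs × (∀ F → Facet F → F ∈ˡ Fs)
    × (∀ (i j : Fin (length Fs)) → i Fin.< j →
         ∃[ v ] (v ∈ (lookup Fs j ─ lookup Fs i)
           × ∃[ ℓ ] (ℓ Fin.< j × (lookup Fs j ─ lookup Fs ℓ) ≡ ⁅ v ⁆)))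

  Shellable : (Subset n → Set) → Set
  Shellable Facet = ∃[ Fs ] IsShelling Facet Fs

-- Induction on the vertex set of a minor (A, B), where A and B are the variables set to 0
-- and to 1. Let x be a free vertex of the minor, lying only in its minimal edge T. A facet
-- containing x is G ∪ {x} for a facet G of the minor (A, B ∪ {x}); a facet avoiding x
-- contains T ∖ x and is G ∪ (T ∖ x) for a facet G of the minor (A ∪ {x}, B ∪ (T ∖ x)).
-- Both translations preserve differences of facets, so shellings of the two smaller minors
-- concatenate, facets containing x first. A facet G avoiding x is attached to an earlier
-- F′ ∋ x through any v ∈ T ∖ F′: exchanging v for x in G and extending to a facet G″ gives
-- G ∖ G″ = {v}. The induction ends at the unit ideal (no facets) and at the zero ideal
-- (one facet, the whole vertex set).
module Submission where

open import Algebra.Bundles using (CommutativeMonoid)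
import Algebra.Properties.CommutativeSemigroup as CommutativeSemigroupProperties
open import Data.Bool using (true)
import Data.Bool.Properties as Bool
open import Data.Empty using (⊥-elim)
open import Data.Fin as Fin using (Fin; zero; suc)
import Data.Fin.Properties as Fin
open import Data.Fin.Subset
open import Data.Fin.Subset.Induction using (⊂-wellFounded; ⊃-wellFounded)
open import Data.Fin.Subset.Properties
open import Data.List using (List; []; _∷_; _++_; length; lookup; map; reverseAcc)
open import Data.List.Membership.Propositional using () renaming (_∈_ to _∈ˡ_)
open import Data.List.Membership.Propositional.Properties
  using (∈-++⁺ˡ; ∈-++⁺ʳ; ∈-++⁻; ∈-map⁺; ∈-map⁻)
open import Data.List.Relation.Unary.All as All using (All; []; _∷_)
import Data.List.Relation.Unary.All.Properties as All
open import Data.List.Relation.Unary.AllPairs using ([]; _∷_)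
open import Data.List.Relation.Unary.Any using (here; there)
import Data.List.Relation.Unary.Any.Properties as Any
open import Data.List.Relation.Unary.Unique.Propositional using (Unique)
open import Data.Nat using (ℕ; z≤n; s≤s)
open import Data.Product using (∃; ∃-syntax; _×_; _,_; proj₁; proj₂)
open import Data.Sum using (_⊎_; inj₁; inj₂; [_,_])
open import Data.Vec using (_∷_) renaming (here to at-head; there to in-tail)
open import Data.Vec.Properties using (≡-dec)
open import Function using (id; _⇔_; mk⇔; Equivalence)
import Function.Properties.Equivalence as ⇔
open import Induction.WellFounded using (Acc; acc)
open import Relation.Binary.PropositionalEquality using (_≡_; _≢_; refl; sym; trans; cong; subst)
open import Relation.Nullary using (¬_; Dec; yes; no; ¬?; contradiction)
open import Relation.Nullary.Decidable using (_×-dec_; decidable-stable)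
open import Relation.Unary using (Decidable)

open import Defs

x∈p─q⇒x∉q : ∀ {n} {x : Fin n} (p q : Subset n) → x ∈ p ─ q → x ∉ q
x∈p─q⇒x∉q {x = zero}  (s ∷ p) (inside  ∷ q) ()
x∈p─q⇒x∉q {x = zero}  (s ∷ p) (outside ∷ q) _ ()
x∈p─q⇒x∉q {x = suc x} (s ∷ p) (t ∷ q) (in-tail x∈) (in-tail x∈q) = x∈p─q⇒x∉q p q x∈ x∈q

module _ {n : ℕ} where

  infix 4 _≟ˢ_
  _≟ˢ_ : (p q : Subset n) → Dec (p ≡ q)
  _≟ˢ_ = ≡-dec Bool._≟_

  x∉p∪q⁺ : ∀ {x : Fin n} {p q} → x ∉ p → x ∉ q → x ∉ p ∪ q
  x∉p∪q⁺ {p = p} {q} x∉p x∉q x∈ = [ x∉p , x∉q ] (x∈p∪q⁻ p q x∈)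

  x∉p∪q⁻ : ∀ {x : Fin n} {p q} → x ∉ p ∪ q → x ∉ p × x ∉ q
  x∉p∪q⁻ x∉ = (λ x∈p → x∉ (x∈p∪q⁺ (inj₁ x∈p))) , (λ x∈q → x∉ (x∈p∪q⁺ (inj₂ x∈q)))

  x∈p∪q∧x∉q⇒x∈p : ∀ {x : Fin n} {p q} → x ∈ p ∪ q → x ∉ q → x ∈ p
  x∈p∪q∧x∉q⇒x∈p {p = p} {q} x∈ x∉q = [ id , (λ x∈q → contradiction x∈q x∉q) ] (x∈p∪q⁻ p q x∈)

  x∈p⇒⁅x⁆⊆p : ∀ {x : Fin n} {p} → x ∈ p → ⁅ x ⁆ ⊆ p
  x∈p⇒⁅x⁆⊆p {x} x∈p y∈ = subst (_∈ _) (sym (x∈⁅y⁆⇒x≡y x y∈)) x∈p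

  p⊆r∧q⊆r⇒p∪q⊆r : ∀ {p q r : Subset n} → p ⊆ r → q ⊆ r → p ∪ q ⊆ r
  p⊆r∧q⊆r⇒p∪q⊆r {p} {q} p⊆r q⊆r x∈ = [ p⊆r , q⊆r ] (x∈p∪q⁻ p q x∈)

  ∪-monoˡ-⊆ : ∀ {p q r : Subset n} → p ⊆ q → p ∪ r ⊆ q ∪ r
  ∪-monoˡ-⊆ {r = r} p⊆q = p⊆r∧q⊆r⇒p∪q⊆r (⊆-trans p⊆q (p⊆p∪q r)) (q⊆p∪q _ r)

  ⊈⇒∃∉ : ∀ {p q : Subset n} → p ⊈ q → ∃ λ x → x ∈ p × x ∉ q
  ⊈⇒∃∉ {p} {q} p⊈q with Fin.any? (λ x → x ∈? p ×-dec ¬? (x ∈? q))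
  ... | yes witness = witness
  ... | no none = ⊥-elim (p⊈q λ {x} x∈p → decidable-stable (x ∈? q) (λ x∉q → none (x , x∈p , x∉q)))

  ∁-involutive : (p : Subset n) → ∁ (∁ p) ≡ p
  ∁-involutive p = ⊆-antisym (λ x∈ → x∉∁p⇒x∈p (x∈∁p⇒x∉p x∈)) (λ x∈p → x∉p⇒x∈∁p (x∈p⇒x∉∁p x∈p))

  ─⊆⇒⊆∪ : ∀ {p q r : Subset n} → p ─ q ⊆ r → p ⊆ r ∪ q
  ─⊆⇒⊆∪ {q = q} p─q⊆r {x} x∈p with x ∈? q
  ... | yes x∈q = x∈p∪q⁺ (inj₂ x∈q)
  ... | no x∉q = x∈p∪q⁺ (inj₁ (p─q⊆r (x∈p∧x∉q⇒x∈p─q x∈p x∉q)))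

  ⊆∪⇒─⊆ : ∀ {p q r : Subset n} → p ⊆ r ∪ q → p ─ q ⊆ r
  ⊆∪⇒─⊆ {p} {q} p⊆r∪q x∈ = x∈p∪q∧x∉q⇒x∈p (p⊆r∪q (p─q⊆p p q x∈)) (x∈p─q⇒x∉q p q x∈)

  p─q∪q≡p : ∀ {p q : Subset n} → q ⊆ p → (p ─ q) ∪ q ≡ p
  p─q∪q≡p {p} {q} q⊆p = ⊆-antisym (p⊆r∧q⊆r⇒p∪q⊆r (p─q⊆p p q) q⊆p) (─⊆⇒⊆∪ id)

  p∪r─q∪r≡p─q : ∀ {p q r : Subset n} → Disjoint p r → (p ∪ r) ─ (q ∪ r) ≡ p ─ q
  p∪r─q∪r≡p─q {p} {q} {r} p#r = ⊆-antisym shrink grow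
    where
    shrink : (p ∪ r) ─ (q ∪ r) ⊆ p ─ q
    shrink x∈ with x∉p∪q⁻ (x∈p─q⇒x∉q (p ∪ r) (q ∪ r) x∈)
    ... | x∉q , x∉r = x∈p∧x∉q⇒x∈p─q (x∈p∪q∧x∉q⇒x∈p (p─q⊆p (p ∪ r) (q ∪ r) x∈) x∉r) x∉q
    grow : p ─ q ⊆ (p ∪ r) ─ (q ∪ r)
    grow {x} x∈ = x∈p∧x∉q⇒x∈p─q (x∈p∪q⁺ (inj₁ x∈p)) (x∉p∪q⁺ (x∈p─q⇒x∉q p q x∈) (p#r x x∈p))
      where
      x∈p : x ∈ p
      x∈p = p─q⊆p p q x∈

module _ {n : ℕ} where

  ShellsOnto : (Subset n → Set) → Subset n → Set
  ShellsOnto Earlier F =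
    ∀ {F′} → Earlier F′ → ∃[ v ] (v ∈ F ─ F′ × ∃[ F″ ] (Earlier F″ × F ─ F″ ≡ ⁅ v ⁆))

  ShellsOnto-resp : ∀ {P Q : Subset n → Set} {F} →
    (∀ {G} → P G → Q G) → (∀ {G} → Q G → P G) → ShellsOnto P F → ShellsOnto Q F
  ShellsOnto-resp P⇒Q Q⇒P shells QF′ with shells (Q⇒P QF′)
  ... | v , v∈ , F″ , PF″ , eq = v , v∈ , F″ , P⇒Q PF″ , eq

  ShellsOnto-++ : ∀ {xs ys F} →
    ShellsOnto (_∈ˡ xs) F → ShellsOnto (_∈ˡ ys) F → ShellsOnto (_∈ˡ xs ++ ys) F
  ShellsOnto-++ {xs} shells-xs shells-ys F′∈ with ∈-++⁻ xs F′∈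
  ... | inj₁ F′∈xs = let v , v∈ , F″ , F″∈ , eq = shells-xs F′∈xs in
    v , v∈ , F″ , ∈-++⁺ˡ F″∈ , eq
  ... | inj₂ F′∈ys = let v , v∈ , F″ , F″∈ , eq = shells-ys F′∈ys in
    v , v∈ , F″ , ∈-++⁺ʳ xs F″∈ , eq

  -- earlier lists the facets already placed, most recent first.
  data ShellingFrom (earlier : List (Subset n)) : List (Subset n) → Set where
    []  : ShellingFrom earlier []
    _∷_ : ∀ {F L} → ShellsOnto (_∈ˡ earlier) F → ShellingFrom (F ∷ earlier) L →
          ShellingFrom earlier (F ∷ L)

  shellingFrom-++ : ∀ {earlier L M} → ShellingFrom earlier L →
    ShellingFrom (reverseAcc earlier L) M → ShellingFrom earlier (L ++ M)
  shellingFrom-++ []           shM = shM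
  shellingFrom-++ (shF ∷ shL) shM = shF ∷ shellingFrom-++ shL shM

  shellingFrom-++ʳ : ∀ {earlier L} more → ShellingFrom earlier L →
    All (ShellsOnto (_∈ˡ more)) L → ShellingFrom (earlier ++ more) L
  shellingFrom-++ʳ more []          []        = []
  shellingFrom-++ʳ more (shF ∷ shL) (s ∷ ss) = ShellsOnto-++ shF s ∷ shellingFrom-++ʳ more shL ss

  shellingFrom-map : ∀ (f : Subset n → Subset n) {P : Subset n → Set} →
    (∀ {F G} → P F → f F ─ f G ≡ F ─ G) →
    ∀ {earlier L} → All P L → ShellingFrom earlier L → ShellingFrom (map f earlier) (map f L)
  shellingFrom-map f f-preserves-─ []          []          = []
  shellingFrom-map f f-preserves-─ {earlier} (_∷_ {F} PF PL) (shF ∷ shL) =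
    shifted ∷ shellingFrom-map f f-preserves-─ PL shL
    where
    shifted : ShellsOnto (_∈ˡ map f earlier) (f F)
    shifted F′∈ with ∈-map⁻ f F′∈
    ... | G , G∈ , refl with shF G∈
    ... | v , v∈ , F″ , F″∈ , eq =
      v , subst (v ∈_) (sym (f-preserves-─ PF)) v∈ ,
      f F″ , ∈-map⁺ f F″∈ , trans (f-preserves-─ PF) eq

  shellingFrom-fresh : ∀ {earlier L F} → ShellingFrom earlier L → F ∈ˡ earlier → All (F ≢_) L
  shellingFrom-fresh []          F∈ = []
  shellingFrom-fresh {F = F} (_∷_ {G} shG shL) F∈ = distinct ∷ shellingFrom-fresh shL (there F∈)
    where
    distinct : F ≢ G
    distinct refl = let v , v∈F─F , _ = shG F∈ in x∈p─q⇒x∉q _ _ v∈F─F (p─q⊆p _ _ v∈F─F)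

  shellingFrom-unique : ∀ {earlier L} → ShellingFrom earlier L → Unique L
  shellingFrom-unique []          = []
  shellingFrom-unique (_ ∷ shL) = shellingFrom-fresh shL (here refl) ∷ shellingFrom-unique shL

  shellingFrom-lookup : ∀ {earlier L} → ShellingFrom earlier L → (j : Fin (length L)) →
    ShellsOnto (λ G → G ∈ˡ earlier ⊎ ∃[ i ] (i Fin.< j × lookup L i ≡ G)) (lookup L j)
  shellingFrom-lookup (shF ∷ _) zero =
    ShellsOnto-resp inj₁ (λ { (inj₁ G∈) → G∈ ; (inj₂ (_ , () , _)) }) shF
  shellingFrom-lookup {earlier} {F ∷ L} (_ ∷ shL) (suc j) =
    ShellsOnto-resp shift unshift (shellingFrom-lookup shL j)
    where
    shift : ∀ {G} → G ∈ˡ F ∷ earlier ⊎ ∃[ i ] (i Fin.< j × lookup L i ≡ G) →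
            G ∈ˡ earlier ⊎ ∃[ i ] (i Fin.< suc j × lookup (F ∷ L) i ≡ G)
    shift (inj₁ (here refl))    = inj₂ (zero , s≤s z≤n , refl)
    shift (inj₁ (there G∈))     = inj₁ G∈
    shift (inj₂ (i , i<j , eq)) = inj₂ (suc i , s≤s i<j , eq)
    unshift : ∀ {G} → G ∈ˡ earlier ⊎ ∃[ i ] (i Fin.< suc j × lookup (F ∷ L) i ≡ G) →
              G ∈ˡ F ∷ earlier ⊎ ∃[ i ] (i Fin.< j × lookup L i ≡ G)
    unshift (inj₁ G∈)                     = inj₁ (there G∈)
    unshift (inj₂ (zero , _ , refl))      = inj₁ (here refl)
    unshift (inj₂ (suc i , s≤s i<j , eq)) = inj₂ (i , i<j , eq)

  ShellingOf : (Subset n → Set) → Set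
  ShellingOf Facet = ∃[ L ] (ShellingFrom [] L × All Facet L × (∀ F → Facet F → F ∈ˡ L))

  ShellingOf-resp : ∀ {P Q : Subset n → Set} →
    (∀ {F} → P F → Q F) → (∀ {F} → Q F → P F) → ShellingOf P → ShellingOf Q
  ShellingOf-resp P⇒Q Q⇒P (L , shL , PL , complete) =
    L , shL , All.map P⇒Q PL , λ F QF → complete F (Q⇒P QF)

  shellable : ∀ {Facet} → ShellingOf Facet → Shellable Facet
  shellable (L , shL , facets , complete) =
    L , shellingFrom-unique shL , facets , complete , attached
    where
    attached : ∀ (i j : Fin (length L)) → i Fin.< j →
      ∃[ v ] (v ∈ lookup L j ─ lookup L i × ∃[ ℓ ] (ℓ Fin.< j × lookup L j ─ lookup L ℓ ≡ ⁅ v ⁆))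
    attached i j i<j with shellingFrom-lookup shL j (inj₂ (i , i<j , refl))
    ... | v , v∈ , _ , inj₂ (ℓ , ℓ<j , refl) , eq = v , v∈ , ℓ , ℓ<j , eq

module _ {n : ℕ} where

  open CommutativeSemigroupProperties
    (CommutativeMonoid.commutativeSemigroup (∪-commutativeMonoid n))
    using (xy∙z≈xz∙y)

  IsMinimal : (Subset n → Set) → Subset n → Set
  IsMinimal P M = P M × (∀ M′ → P M′ → M′ ⊆ M → M′ ≡ M)

  IsMaximal : Subset n → (Subset n → Set) → Subset n → Set
  IsMaximal W I G = G ⊆ W × I G × (∀ {v} → v ∈ W → v ∉ G → ¬ I (G ∪ ⁅ v ⁆))

  Antitone : (Subset n → Set) → Set
  Antitone I = ∀ {G G′} → G′ ⊆ G → I G → I G′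

  minimal-⊆ : ∀ {P} → Decidable P → ∀ {T} → Acc _⊂_ T → P T → ∃[ M ] (IsMinimal P M × M ⊆ T)
  minimal-⊆ P? {T} (acc smaller) PT with anySubset? (λ T′ → P? T′ ×-dec T′ ⊂? T)
  ... | yes (T′ , PT′ , T′⊂T) with minimal-⊆ P? (smaller T′⊂T) PT′
  ...   | M , minM , M⊆T′ = M , minM , ⊆-trans M⊆T′ (p⊂q⇒p⊆q T′⊂T)
  minimal-⊆ {P} P? {T} _ PT | no none = T , (PT , minimal) , ⊆-refl
    where
    minimal : ∀ T′ → P T′ → T′ ⊆ T → T′ ≡ T
    minimal T′ PT′ T′⊆T with T ⊆? T′
    ... | yes T⊆T′ = ⊆-antisym T′⊆T T⊆T′
    ... | no T⊈T′  = ⊥-elim (none (T′ , PT′ , T′⊆T , ⊈⇒∃∉ T⊈T′))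

  maximal-⊇ : ∀ {W I} → Decidable I → ∀ {K} → Acc _⊃_ K → K ⊆ W → I K →
    ∃[ G ] (IsMaximal W I G × K ⊆ G)
  maximal-⊇ {W} I? {K} (acc larger) K⊆W IK
    with Fin.any? (λ v → v ∈? W ×-dec ¬? (v ∈? K) ×-dec I? (K ∪ ⁅ v ⁆))
  ... | yes (v , v∈W , v∉K , IKv)
    with maximal-⊇ I? (larger K⊂Kv) (p⊆r∧q⊆r⇒p∪q⊆r K⊆W (x∈p⇒⁅x⁆⊆p v∈W)) IKv
    where
    K⊂Kv : K ⊂ K ∪ ⁅ v ⁆
    K⊂Kv = p⊆p∪q ⁅ v ⁆ , v , x∈p∪q⁺ (inj₂ (x∈⁅x⁆ v)) , v∉K
  ...   | G , maxG , Kv⊆G = G , maxG , ⊆-trans (p⊆p∪q ⁅ v ⁆) Kv⊆G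
  maximal-⊇ I? _ K⊆W IK | no none =
    _ , (K⊆W , IK , λ v∈W v∉K IKv → none (_ , v∈W , v∉K , IKv)) , ⊆-refl

  maximal≡top : ∀ {W I G} → Antitone I → I W → IsMaximal W I G → G ≡ W
  maximal≡top {W} {G = G} antitone IW (G⊆W , _ , maxG) = ⊆-antisym G⊆W W⊆G
    where
    W⊆G : W ⊆ G
    W⊆G {v} v∈W = decidable-stable (v ∈? G) λ v∉G →
      maxG v∈W v∉G (antitone (p⊆r∧q⊆r⇒p∪q⊆r G⊆W (x∈p⇒⁅x⁆⊆p v∈W)) IW)

  module Transfer {W W′ C : Subset n} {I I′ : Subset n → Set}
    (W′⊆W : W′ ⊆ W) (transfer : ∀ {H} → H ⊆ W′ → I′ H ⇔ I (H ∪ C)) where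

    open Equivalence

    maximal-∪ : ∀ {H} → C ⊆ W →
      (∀ {v} → v ∈ W → v ∉ W′ → v ∉ C → ¬ I ((H ∪ C) ∪ ⁅ v ⁆)) →
      IsMaximal W′ I′ H → IsMaximal W I (H ∪ C)
    maximal-∪ {H} C⊆W blocked (H⊆W′ , I′H , maxH) =
      p⊆r∧q⊆r⇒p∪q⊆r (⊆-trans H⊆W′ W′⊆W) C⊆W , to (transfer H⊆W′) I′H , max
      where
      max : ∀ {v} → v ∈ W → v ∉ H ∪ C → ¬ I ((H ∪ C) ∪ ⁅ v ⁆)
      max {v} v∈W v∉H∪C IHCv with x∉p∪q⁻ v∉H∪C | v ∈? W′
      ... | _ , v∉C | no v∉W′ = blocked v∈W v∉W′ v∉C IHCv
      ... | v∉H , _ | yes v∈W′ =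
        maxH v∈W′ v∉H (from (transfer Hv⊆W′) (subst I (xy∙z≈xz∙y H C ⁅ v ⁆) IHCv))
        where
        Hv⊆W′ : H ∪ ⁅ v ⁆ ⊆ W′
        Hv⊆W′ = p⊆r∧q⊆r⇒p∪q⊆r H⊆W′ (x∈p⇒⁅x⁆⊆p v∈W′)

    maximal-─ : ∀ {G} → Disjoint W′ C → C ⊆ G → G ─ C ⊆ W′ →
      IsMaximal W I G → IsMaximal W′ I′ (G ─ C)
    maximal-─ {G} W′#C C⊆G G─C⊆W′ (_ , IG , maxG) = G─C⊆W′ , I′G─C , max
      where
      I′G─C : I′ (G ─ C)
      I′G─C = from (transfer G─C⊆W′) (subst I (sym (p─q∪q≡p C⊆G)) IG)
      max : ∀ {v} → v ∈ W′ → v ∉ G ─ C → ¬ I′ ((G ─ C) ∪ ⁅ v ⁆)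
      max {v} v∈W′ v∉G─C I′Gv = maxG (W′⊆W v∈W′) v∉G IGv
        where
        v∉G : v ∉ G
        v∉G v∈G = v∉G─C (x∈p∧x∉q⇒x∈p─q v∈G (W′#C v v∈W′))
        IGv : I (G ∪ ⁅ v ⁆)
        IGv = subst I (trans (xy∙z≈xz∙y (G ─ C) ⁅ v ⁆ C) (cong (_∪ ⁅ v ⁆) (p─q∪q≡p C⊆G)))
                (to (transfer (p⊆r∧q⊆r⇒p∪q⊆r G─C⊆W′ (x∈p⇒⁅x⁆⊆p v∈W′))) I′Gv)

module Minors {n : ℕ} (E : Family n) where

  open CommutativeSemigroupProperties
    (CommutativeMonoid.commutativeSemigroup (∪-commutativeMonoid n))
    using (x∙yz≈xz∙y)

  Vertices : Subset n → Subset n → Subset n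
  Vertices A B = ∁ (A ∪ B)

  -- The faces of the Stanley–Reisner complex of the minor (A, B) are the independent
  -- subsets of its vertex set.
  Dependent : Subset n → Subset n → Subset n → Set
  Dependent A B G = ∃[ S ] (IsEdge E S × Empty (S ∩ A) × S ⊆ G ∪ B)

  Independent : Subset n → Subset n → Subset n → Set
  Independent A B G = ¬ Dependent A B G

  IsFacet : Subset n → Subset n → Subset n → Set
  IsFacet A B = IsMaximal (Vertices A B) (Independent A B)

  ∈-vertices⁺ : ∀ {A B y} → y ∉ A → y ∉ B → y ∈ Vertices A B
  ∈-vertices⁺ y∉A y∉B = x∉p⇒x∈∁p (x∉p∪q⁺ y∉A y∉B)

  ∈-vertices⁻ : ∀ {A B y} → y ∈ Vertices A B → y ∉ A × y ∉ B
  ∈-vertices⁻ y∈ = x∉p∪q⁻ (x∈∁p⇒x∉p y∈)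

  vertices-antitone : ∀ {A A′ B B′} → A ⊆ A′ → B ⊆ B′ → Vertices A′ B′ ⊆ Vertices A B
  vertices-antitone {A′ = A′} {B′ = B′} A⊆A′ B⊆B′ =
    p⊆q⇒∁p⊇∁q (p⊆r∧q⊆r⇒p∪q⊆r (⊆-trans A⊆A′ (p⊆p∪q B′)) (⊆-trans B⊆B′ (q⊆p∪q A′ B′)))

  vertices#∪ˡ : ∀ {A B D} → Disjoint (Vertices (A ∪ D) B) D
  vertices#∪ˡ y y∈ = proj₂ (x∉p∪q⁻ (proj₁ (∈-vertices⁻ y∈)))

  vertices#∪ʳ : ∀ {A B C} → Disjoint (Vertices A (B ∪ C)) C
  vertices#∪ʳ y y∈ = proj₂ (x∉p∪q⁻ (proj₂ (∈-vertices⁻ y∈)))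

  facet#∪ʳ : ∀ {A B C F} → IsFacet A (B ∪ C) F → Disjoint F C
  facet#∪ʳ (F⊆V , _) y y∈F = vertices#∪ʳ y (F⊆V y∈F)

  dependent? : ∀ A B → Decidable (Dependent A B)
  dependent? A B G = anySubset? λ S →
    (E S Bool.≟ true) ×-dec ¬? (nonempty? (S ∩ A)) ×-dec (S ⊆? G ∪ B)

  independent? : ∀ A B → Decidable (Independent A B)
  independent? A B G = ¬? (dependent? A B G)

  reducedEdge? : ∀ A B → Decidable (ReducedEdge E A B)
  reducedEdge? A B T = anySubset? λ S →
    (E S Bool.≟ true) ×-dec ¬? (nonempty? (S ∩ A)) ×-dec (T ≟ˢ S ─ B)

  independent-antitone : ∀ {A B} → Antitone (Independent A B)
  independent-antitone G′⊆G indepG (S , e , S#A , S⊆G′∪B) =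
    indepG (S , e , S#A , ⊆-trans S⊆G′∪B (∪-monoˡ-⊆ G′⊆G))

  reduced⊈ : ∀ {A B G T} → Independent A B G → ReducedEdge E A B T → T ⊈ G
  reduced⊈ indepG (S , e , S#A , refl) S─B⊆G = indepG (S , e , S#A , ─⊆⇒⊆∪ S─B⊆G)

  reduced⊆vertices : ∀ {A B T} → ReducedEdge E A B T → T ⊆ Vertices A B
  reduced⊆vertices {B = B} (S , _ , S#A , refl) y∈ =
    ∈-vertices⁺ (λ y∈A → S#A (_ , x∈p∩q⁺ (p─q⊆p S B y∈ , y∈A))) (x∈p─q⇒x∉q S B y∈)

  reduced-nonempty : ∀ {A B T} → Independent A B ⊥ → ReducedEdge E A B T → Nonempty T
  reduced-nonempty {T = T} indep⊥ (S , e , S#A , refl) = decidable-stable (nonempty? T) λ empty →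
    indep⊥ (S , e , S#A , ─⊆⇒⊆∪ (λ y∈ → ⊥-elim (empty (_ , y∈))))

  independent-ones : ∀ {A B C H} → Independent A (B ∪ C) H ⇔ Independent A B (H ∪ C)
  independent-ones {B = B} {C} {H} = mk⇔
    (λ indep (S , e , S#A , S⊆) → indep (S , e , S#A , subst (S ⊆_) (sym H∪[B∪C]≡[H∪C]∪B) S⊆))
    (λ indep (S , e , S#A , S⊆) → indep (S , e , S#A , subst (S ⊆_) H∪[B∪C]≡[H∪C]∪B S⊆))
    where
    H∪[B∪C]≡[H∪C]∪B : H ∪ (B ∪ C) ≡ (H ∪ C) ∪ B
    H∪[B∪C]≡[H∪C]∪B = x∙yz≈xz∙y H B C

  independent-zeros : ∀ {A B D G} → Disjoint D (G ∪ B) →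
    Independent (A ∪ D) B G ⇔ Independent A B G
  independent-zeros {A} {B} {D} {G} D#G∪B = mk⇔
    (λ indep (S , e , S#A , S⊆) → indep (S , e , S#A∪D S#A S⊆ , S⊆))
    (λ indep (S , e , S#A∪D , S⊆) → indep (S , e , (λ (y , y∈) → S#A∪D (y , S∩A⊆S∩[A∪D] y∈)) , S⊆))
    where
    S∩A⊆S∩[A∪D] : ∀ {S} → S ∩ A ⊆ S ∩ (A ∪ D)
    S∩A⊆S∩[A∪D] {S} y∈ = let y∈S , y∈A = x∈p∩q⁻ S A y∈ in x∈p∩q⁺ (y∈S , x∈p∪q⁺ (inj₁ y∈A))
    S#A∪D : ∀ {S} → Empty (S ∩ A) → S ⊆ G ∪ B → Empty (S ∩ (A ∪ D))
    S#A∪D {S} S#A S⊆ (y , y∈) with x∈p∩q⁻ S (A ∪ D) y∈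
    ... | y∈S , y∈A∪D = [ (λ y∈A → S#A (y , x∈p∩q⁺ (y∈S , y∈A))) , (λ y∈D → D#G∪B y y∈D (S⊆ y∈S)) ]
                          (x∈p∪q⁻ A D y∈A∪D)

  module FreeVertex {A B : Subset n} {x : Fin n} {T : Subset n}
    (T-reduced : ReducedEdge E A B T) (x∈T : x ∈ T)
    (T-unique : ∀ T′ → MinorEdge E A B T′ → x ∈ T′ → T′ ≡ T) where

    T∖x : Subset n
    T∖x = T - x

    T⊆V : T ⊆ Vertices A B
    T⊆V = reduced⊆vertices T-reduced

    x∈V : x ∈ Vertices A B
    x∈V = T⊆V x∈T

    x∉T∖x : x ∉ T∖x
    x∉T∖x x∈ = x∈p─q⇒x∉q T ⁅ x ⁆ x∈ (x∈⁅x⁆ x)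

    -- A minimal edge of the minor inside S ─ B either contains x, and is then T, or lies in G.
    free-edge-⊆ : ∀ {G S} → Independent A B G → IsEdge E S → Empty (S ∩ A) →
      S ⊆ (G ∪ ⁅ x ⁆) ∪ B → T ⊆ S
    free-edge-⊆ {G} {S} indepG e S#A S⊆
      with minimal-⊆ (reducedEdge? A B) (⊂-wellFounded _) (S , e , S#A , refl)
    ... | M , minorM , M⊆S─B with x ∈? M
    ...   | yes x∈M = λ y∈T → p─q⊆p S B (M⊆S─B (subst (_ ∈_) (sym (T-unique M minorM x∈M)) y∈T))
    ...   | no x∉M = ⊥-elim (reduced⊈ indepG (proj₁ minorM) M⊆G)
      where
      M⊆G : M ⊆ G
      M⊆G y∈M = x∈p∪q∧x∉q⇒x∈p (⊆∪⇒─⊆ S⊆ (M⊆S─B y∈M))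
        λ y∈⁅x⁆ → x∉M (subst (_∈ M) (x∈⁅y⁆⇒x≡y x y∈⁅x⁆) y∈M)

    facet∌x⇒T∖x⊆ : ∀ {G} → IsFacet A B G → x ∉ G → T∖x ⊆ G
    facet∌x⇒T∖x⊆ (_ , indepG , maxG) x∉G {y} y∈T∖x
      with decidable-stable (dependent? A B _) (maxG x∈V x∉G)
    ... | S , e , S#A , S⊆ =
      x∈p∪q∧x∉q⇒x∈p (⊆∪⇒─⊆ S⊆ (x∈p∧x∉q⇒x∈p─q y∈S y∉B)) (x∈p─q⇒x∉q T ⁅ x ⁆ y∈T∖x)
      where
      y∈T : y ∈ T
      y∈T = p─q⊆p T ⁅ x ⁆ y∈T∖x
      y∈S : y ∈ S
      y∈S = free-edge-⊆ indepG e S#A S⊆ y∈T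
      y∉B : y ∉ B
      y∉B = proj₂ (∈-vertices⁻ (T⊆V y∈T))

    link-vertex : ∀ {y} → y ∈ Vertices A B → y ∉ ⁅ x ⁆ → y ∈ Vertices A (B ∪ ⁅ x ⁆)
    link-vertex y∈V y∉x = let y∉A , y∉B = ∈-vertices⁻ y∈V in ∈-vertices⁺ y∉A (x∉p∪q⁺ y∉B y∉x)

    link-vertices⊂ : Vertices A (B ∪ ⁅ x ⁆) ⊂ Vertices A B
    link-vertices⊂ =
      vertices-antitone ⊆-refl (p⊆p∪q ⁅ x ⁆) , x , x∈V , λ x∈ → vertices#∪ʳ x x∈ (x∈⁅x⁆ x)

    module Link = Transfer {C = ⁅ x ⁆} {I = Independent A B} {I′ = Independent A (B ∪ ⁅ x ⁆)}
      (proj₁ link-vertices⊂) (λ _ → independent-ones)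

    link-facet⁺ : ∀ {H} → IsFacet A (B ∪ ⁅ x ⁆) H → IsFacet A B (H ∪ ⁅ x ⁆)
    link-facet⁺ = Link.maximal-∪ (x∈p⇒⁅x⁆⊆p x∈V) λ v∈V v∉V′ v∉x _ → v∉V′ (link-vertex v∈V v∉x)

    link-facet⁻ : ∀ {G} → IsFacet A B G → x ∈ G → IsFacet A (B ∪ ⁅ x ⁆) (G - x)
    link-facet⁻ {G} facetG x∈G = Link.maximal-─ vertices#∪ʳ (x∈p⇒⁅x⁆⊆p x∈G) G-x⊆V′ facetG
      where
      G-x⊆V′ : G - x ⊆ Vertices A (B ∪ ⁅ x ⁆)
      G-x⊆V′ y∈ = link-vertex (proj₁ facetG (p─q⊆p G ⁅ x ⁆ y∈)) (x∈p─q⇒x∉q G ⁅ x ⁆ y∈)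

    deletion-vertex : ∀ {y} → y ∈ Vertices A B → y ≢ x → y ∉ T∖x →
      y ∈ Vertices (A ∪ ⁅ x ⁆) (B ∪ T∖x)
    deletion-vertex y∈V y≢x y∉T∖x = let y∉A , y∉B = ∈-vertices⁻ y∈V in
      ∈-vertices⁺ (x∉p∪q⁺ y∉A (x≢y⇒x∉⁅y⁆ y≢x)) (x∉p∪q⁺ y∉B y∉T∖x)

    deletion-vertices⊂ : Vertices (A ∪ ⁅ x ⁆) (B ∪ T∖x) ⊂ Vertices A B
    deletion-vertices⊂ =
      vertices-antitone (p⊆p∪q ⁅ x ⁆) (p⊆p∪q T∖x) , x , x∈V , λ x∈ → vertices#∪ˡ x x∈ (x∈⁅x⁆ x)

    deletion-transfer : ∀ {H} → H ⊆ Vertices (A ∪ ⁅ x ⁆) (B ∪ T∖x) →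
      Independent (A ∪ ⁅ x ⁆) (B ∪ T∖x) H ⇔ Independent A B (H ∪ T∖x)
    deletion-transfer {H} H⊆V′ = ⇔.trans (independent-zeros x#H∪B∪T∖x) independent-ones
      where
      x#H∪B∪T∖x : Disjoint ⁅ x ⁆ (H ∪ (B ∪ T∖x))
      x#H∪B∪T∖x y y∈x rewrite x∈⁅y⁆⇒x≡y x y∈x =
        x∉p∪q⁺ (λ x∈H → vertices#∪ˡ x (H⊆V′ x∈H) (x∈⁅x⁆ x)) (x∉p∪q⁺ (proj₂ (∈-vertices⁻ x∈V)) x∉T∖x)

    module Deletion = Transfer {C = T∖x} {I = Independent A B}
      (proj₁ deletion-vertices⊂) deletion-transfer

    deletion-facet⁺ : ∀ {H} → IsFacet (A ∪ ⁅ x ⁆) (B ∪ T∖x) H → IsFacet A B (H ∪ T∖x)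
    deletion-facet⁺ {H} = Deletion.maximal-∪ (⊆-trans (p─q⊆p T ⁅ x ⁆) T⊆V) blocked
      where
      blocked : ∀ {v} → v ∈ Vertices A B → v ∉ Vertices (A ∪ ⁅ x ⁆) (B ∪ T∖x) → v ∉ T∖x →
        ¬ Independent A B ((H ∪ T∖x) ∪ ⁅ v ⁆)
      blocked {v} v∈V v∉V′ v∉T∖x indep with v Fin.≟ x
      ... | no v≢x = v∉V′ (deletion-vertex v∈V v≢x v∉T∖x)
      ... | yes refl = reduced⊈ indep T-reduced (⊆-trans (─⊆⇒⊆∪ id) (∪-monoˡ-⊆ (q⊆p∪q H T∖x)))

    deletion-facet⁻ : ∀ {G} → IsFacet A B G → x ∉ G → IsFacet (A ∪ ⁅ x ⁆) (B ∪ T∖x) (G ─ T∖x)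
    deletion-facet⁻ {G} facetG x∉G =
      Deletion.maximal-─ vertices#∪ʳ (facet∌x⇒T∖x⊆ facetG x∉G) G─T∖x⊆V′ facetG
      where
      G─T∖x⊆V′ : G ─ T∖x ⊆ Vertices (A ∪ ⁅ x ⁆) (B ∪ T∖x)
      G─T∖x⊆V′ {y} y∈ =
        deletion-vertex (proj₁ facetG y∈G) (λ { refl → x∉G y∈G }) (x∈p─q⇒x∉q G T∖x y∈)
        where
        y∈G : y ∈ G
        y∈G = p─q⊆p G T∖x y∈

    exchange-independent : ∀ {G v} → Independent A B G → v ∈ T∖x →
      Independent A B ((G - v) ∪ ⁅ x ⁆)
    exchange-independent {G} {v} indepG v∈T∖x (S , e , S#A , S⊆) = v∉ (S⊆ v∈S)
      where
      v∈T : v ∈ T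
      v∈T = p─q⊆p T ⁅ x ⁆ v∈T∖x
      v∈S : v ∈ S
      v∈S = free-edge-⊆ (independent-antitone (p─q⊆p G ⁅ v ⁆) indepG) e S#A S⊆ v∈T
      v∉ : v ∉ ((G - v) ∪ ⁅ x ⁆) ∪ B
      v∉ = x∉p∪q⁺ (x∉p∪q⁺ (λ v∈ → x∈p─q⇒x∉q G ⁅ v ⁆ v∈ (x∈⁅x⁆ v)) (x∈p─q⇒x∉q T ⁅ x ⁆ v∈T∖x))
                  (proj₂ (∈-vertices⁻ (T⊆V v∈T)))

    exchange : ∀ {G v} → IsFacet A B G → x ∉ G → v ∈ T∖x →
      ∃[ G″ ] (IsFacet A B G″ × x ∈ G″ × G ─ G″ ≡ ⁅ v ⁆)
    exchange {G} {v} facetG@(G⊆V , indepG , _) x∉G v∈T∖x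
      with maximal-⊇ (independent? A B) (⊃-wellFounded _)
             (p⊆r∧q⊆r⇒p∪q⊆r (⊆-trans (p─q⊆p G ⁅ v ⁆) G⊆V) (x∈p⇒⁅x⁆⊆p x∈V))
             (exchange-independent indepG v∈T∖x)
    ... | G″ , facetG″@(_ , indepG″ , _) , G-v∪x⊆G″ =
      G″ , facetG″ , x∈G″ , ⊆-antisym G─G″⊆v (x∈p⇒⁅x⁆⊆p (x∈p∧x∉q⇒x∈p─q v∈G v∉G″))
      where
      x∈G″ : x ∈ G″
      x∈G″ = G-v∪x⊆G″ (x∈p∪q⁺ (inj₂ (x∈⁅x⁆ x)))
      G-v⊆G″ : G - v ⊆ G″
      G-v⊆G″ = ⊆-trans (p⊆p∪q ⁅ x ⁆) G-v∪x⊆G″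
      v∈G : v ∈ G
      v∈G = facet∌x⇒T∖x⊆ facetG x∉G v∈T∖x
      G─G″⊆v : G ─ G″ ⊆ ⁅ v ⁆
      G─G″⊆v {y} y∈ = decidable-stable (y ∈? ⁅ v ⁆) λ y∉v →
        x∈p─q⇒x∉q G G″ y∈ (G-v⊆G″ (x∈p∧x∉q⇒x∈p─q (p─q⊆p G G″ y∈) y∉v))
      v∉G″ : v ∉ G″
      v∉G″ v∈G″ = reduced⊈ indepG″ T-reduced
        (⊆-trans (─⊆⇒⊆∪ id) (p⊆r∧q⊆r⇒p∪q⊆r T∖x⊆G″ (x∈p⇒⁅x⁆⊆p x∈G″)))
        where
        T∖x⊆G″ : T∖x ⊆ G″
        T∖x⊆G″ = ⊆-trans (facet∌x⇒T∖x⊆ facetG x∉G)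
                   (⊆-trans (─⊆⇒⊆∪ id) (p⊆r∧q⊆r⇒p∪q⊆r G-v⊆G″ (x∈p⇒⁅x⁆⊆p v∈G″)))

    facet-cross : ∀ {G} → IsFacet A B G → x ∉ G → ShellsOnto (λ G′ → IsFacet A B G′ × x ∈ G′) G
    facet-cross {G} facetG x∉G ((_ , indepG′ , _) , x∈G′) with ⊈⇒∃∉ (reduced⊈ indepG′ T-reduced)
    ... | v , v∈T , v∉G′ with exchange facetG x∉G (x∈p∧x≢y⇒x∈p-y v∈T λ { refl → v∉G′ x∈G′ })
    ...   | G″ , facetG″ , x∈G″ , G─G″≡v =
      v , x∈p∧x∉q⇒x∈p─q v∈G v∉G′ , G″ , (facetG″ , x∈G″) , G─G″≡v
      where
      v∈G : v ∈ G
      v∈G = p─q⊆p G G″ (subst (v ∈_) (sym G─G″≡v) (x∈⁅x⁆ v))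

    shelling-∪ : ShellingOf (IsFacet A (B ∪ ⁅ x ⁆)) → ShellingOf (IsFacet (A ∪ ⁅ x ⁆) (B ∪ T∖x)) →
      ShellingOf (IsFacet A B)
    shelling-∪ (L₁ , sh₁ , facets₁ , complete₁) (L₂ , sh₂ , facets₂ , complete₂) =
      with-x ++ without-x ,
      shellingFrom-++ sh-with-x (shellingFrom-++ʳ _ sh-without-x crossing) ,
      All.++⁺ (All.map⁺ (All.map link-facet⁺ facets₁))
              (All.map⁺ (All.map deletion-facet⁺ facets₂)) ,
      complete
      where
      with-x without-x : List (Subset n)
      with-x = map (_∪ ⁅ x ⁆) L₁
      without-x = map (_∪ T∖x) L₂
      sh-with-x : ShellingFrom [] with-x
      sh-with-x = shellingFrom-map (_∪ ⁅ x ⁆) (λ facet → p∪r─q∪r≡p─q (facet#∪ʳ facet)) facets₁ sh₁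
      sh-without-x : ShellingFrom [] without-x
      sh-without-x = shellingFrom-map (_∪ T∖x) (λ facet → p∪r─q∪r≡p─q (facet#∪ʳ facet)) facets₂ sh₂
      in-with-x : ∀ {G} → IsFacet A B G → x ∈ G → G ∈ˡ with-x
      in-with-x facetG x∈G = subst (_∈ˡ with-x) (p─q∪q≡p (x∈p⇒⁅x⁆⊆p x∈G))
        (∈-map⁺ _ (complete₁ _ (link-facet⁻ facetG x∈G)))
      from-with-x : ∀ {G} → G ∈ˡ reverseAcc [] with-x → IsFacet A B G × x ∈ G
      from-with-x G∈ with ∈-map⁻ (_∪ ⁅ x ⁆) (Any.reverse⁻ G∈)
      ... | H , H∈ , refl = link-facet⁺ (All.lookup facets₁ H∈) , x∈p∪q⁺ (inj₂ (x∈⁅x⁆ x))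
      shells-onto-with-x : ∀ {H} → IsFacet (A ∪ ⁅ x ⁆) (B ∪ T∖x) H →
        ShellsOnto (_∈ˡ reverseAcc [] with-x) (H ∪ T∖x)
      shells-onto-with-x {H} facetH =
        ShellsOnto-resp (λ (facetG , x∈G) → Any.reverse⁺ (in-with-x facetG x∈G)) from-with-x
          (facet-cross (deletion-facet⁺ facetH) (x∉p∪q⁺ x∉H x∉T∖x))
        where
        x∉H : x ∉ H
        x∉H x∈H = vertices#∪ˡ x (proj₁ facetH x∈H) (x∈⁅x⁆ x)
      crossing : All (ShellsOnto (_∈ˡ reverseAcc [] with-x)) without-x
      crossing = All.map⁺ (All.map shells-onto-with-x facets₂)
      complete : ∀ G → IsFacet A B G → G ∈ˡ with-x ++ without-x
      complete G facetG with x ∈? G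
      ... | yes x∈G = ∈-++⁺ˡ (in-with-x facetG x∈G)
      ... | no x∉G = ∈-++⁺ʳ with-x (subst (_∈ˡ without-x) (p─q∪q≡p (facet∌x⇒T∖x⊆ facetG x∉G))
                       (∈-map⁺ _ (complete₂ _ (deletion-facet⁻ facetG x∉G))))

  minor-shelling : (∀ A B → IsProperMinor E A B → HasFreeVertex (MinorEdge E A B)) →
    ∀ A B → Acc _⊂_ (Vertices A B) → Disjoint A B → ShellingOf (IsFacet A B)
  minor-shelling free A B (acc smaller) A#B with dependent? A B ⊥
  ... | yes ⊥-dependent =
    [] , [] , [] , λ G (_ , indepG , _) → ⊥-elim (independent-antitone (⊆-min G) indepG ⊥-dependent)
  ... | no ⊥-independent with dependent? A B (Vertices A B)
  ...   | no V-independent =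
    Vertices A B ∷ [] , (λ ()) ∷ [] , (⊆-refl , V-independent , λ v∈V v∉V _ → v∉V v∈V) ∷ [] ,
    λ G facetG → here (maximal≡top independent-antitone V-independent facetG)
  ...   | yes (S , e , S#A , _)
    with free A B (A#B , (S ─ B , S , e , S#A , refl) , λ T → reduced-nonempty ⊥-independent)
  ...     | x , T , (T-reduced , _) , x∈T , T-unique =
    shelling-∪
      (minor-shelling free A (B ∪ ⁅ x ⁆) (smaller link-vertices⊂) link-disjoint)
      (minor-shelling free (A ∪ ⁅ x ⁆) (B ∪ T∖x) (smaller deletion-vertices⊂) deletion-disjoint)
    where
    open FreeVertex T-reduced x∈T T-unique
    link-disjoint : Disjoint A (B ∪ ⁅ x ⁆)
    link-disjoint y y∈A = x∉p∪q⁺ (A#B y y∈A) λ y∈x →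
      proj₁ (∈-vertices⁻ x∈V) (subst (_∈ A) (x∈⁅y⁆⇒x≡y x y∈x) y∈A)
    deletion-disjoint : Disjoint (A ∪ ⁅ x ⁆) (B ∪ T∖x)
    deletion-disjoint y y∈A∪x with x∈p∪q⁻ A ⁅ x ⁆ y∈A∪x
    ... | inj₁ y∈A = x∉p∪q⁺ (A#B y y∈A) λ y∈T∖x →
      proj₁ (∈-vertices⁻ (T⊆V (p─q⊆p T ⁅ x ⁆ y∈T∖x))) y∈A
    ... | inj₂ y∈x rewrite x∈⁅y⁆⇒x≡y x y∈x = x∉p∪q⁺ (proj₂ (∈-vertices⁻ x∈V)) x∉T∖x

  independent⇒cover : ∀ {G} → Independent ⊥ ⊥ G → IsVertexCover E (∁ G)
  independent⇒cover {G} indepG S e with ⊈⇒∃∉ S⊈G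
    where
    S⊈G : S ⊈ G
    S⊈G S⊆G = indepG (S , e , (λ (_ , y∈) → ∉⊥ (proj₂ (x∈p∩q⁻ S ⊥ y∈))) , ⊆-trans S⊆G (p⊆p∪q ⊥))
  ... | y , y∈S , y∉G = y , x∈p∩q⁺ (y∈S , x∉p⇒x∈∁p y∉G)

  cover⇒independent : ∀ {C} → IsVertexCover E C → Independent ⊥ ⊥ (∁ C)
  cover⇒independent {C} cover (S , e , _ , S⊆) with cover S e
  ... | y , y∈ with x∈p∩q⁻ S C y∈
  ...   | y∈S , y∈C = x∈∁p⇒x∉p (x∈p∪q∧x∉q⇒x∈p (S⊆ y∈S) ∉⊥) y∈C

  facet⇒facetΔ : ∀ {G} → IsFacet ⊥ ⊥ G → IsFacetΔ E G
  facet⇒facetΔ {G} (_ , indepG , maxG) =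
    ∁ G , (independent⇒cover indepG , minimal) , sym (∁-involutive G)
    where
    minimal : ∀ C → IsVertexCover E C → C ⊆ ∁ G → C ≡ ∁ G
    minimal C cover C⊆∁G = ⊆-antisym C⊆∁G λ {y} y∈∁G → decidable-stable (y ∈? C) λ y∉C →
      maxG (∈-vertices⁺ ∉⊥ ∉⊥) (x∈∁p⇒x∉p y∈∁G)
        (independent-antitone (p⊆r∧q⊆r⇒p∪q⊆r G⊆∁C (x∈p⇒⁅x⁆⊆p (x∉p⇒x∈∁p y∉C)))
          (cover⇒independent cover))
      where
      G⊆∁C : G ⊆ ∁ C
      G⊆∁C z∈G = x∉p⇒x∈∁p λ z∈C → x∈∁p⇒x∉p (C⊆∁G z∈C) z∈G

  facetΔ⇒facet : ∀ {F} → IsFacetΔ E F → IsFacet ⊥ ⊥ F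
  facetΔ⇒facet (C , (cover , minimal) , refl) =
    (λ _ → ∈-vertices⁺ ∉⊥ ∉⊥) , cover⇒independent cover , maximal
    where
    maximal : ∀ {v} → v ∈ Vertices ⊥ ⊥ → v ∉ ∁ C → ¬ Independent ⊥ ⊥ (∁ C ∪ ⁅ v ⁆)
    maximal {v} _ v∉∁C indep = x∈∁p⇒x∉p v∈C′ (x∈p∪q⁺ (inj₂ (x∈⁅x⁆ v)))
      where
      C′ : Subset n
      C′ = ∁ (∁ C ∪ ⁅ v ⁆)
      C′⊆C : C′ ⊆ C
      C′⊆C y∈ = x∉∁p⇒x∈p λ y∈∁C → x∈∁p⇒x∉p y∈ (x∈p∪q⁺ (inj₁ y∈∁C))
      v∈C′ : v ∈ C′
      v∈C′ = subst (v ∈_) (sym (minimal C′ (independent⇒cover indep) C′⊆C)) (x∉∁p⇒x∈p v∉∁C)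

open Minors using (minor-shelling; facet⇒facetΔ; facetΔ⇒facet)

theorem5p3 : (n : ℕ) (E : Family n) → IsClutter E → FreeVertexProperty E →
    Shellable (IsFacetΔ E)
theorem5p3 n E _ (_ , minors-have-free-vertices) =
  shellable (ShellingOf-resp (facet⇒facetΔ E) (facetΔ⇒facet E)
    (minor-shelling E minors-have-free-vertices ⊥ ⊥ (⊂-wellFounded _) λ _ y∈⊥ _ → ∉⊥ y∈⊥))
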